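{- For integers $n,k$ with $\lfloor 5k/2\rfloor\leq n\leq 3k-2$, the metric dimension of the Kneser graph $K(n,k)$ satisfies \[ \beta(K(n,k))\leq 2\binom{n-k}{k}. \]
   Context: The Kneser graph $K(n,k)$ has as vertices the $k$-subsets of $[n]=\{1,\dots,n\}$, two being adjacent when they are disjoint. A resolving set of a connected graph is a set $S$ of vertices such that for every pair of distinct vertices $u,v$ there is $x\in S$ with $d(u,x)\neq d(v,x)$; the metric dimension $\beta$ is the minimum size of a resolving set. -}

module Defs where

open import Data.Nat using (ℕ; zero; suc; _<_)
open import Data.Fin.Subset using (Subset; ∣_∣; _∩_; ⊥)
open import Data.Product using (Σ; ∃; _×_; _,_; proj₁)
open import Data.List using (List)
open import Data.List.Membership.Propositional using (_∈_)
open import Relation.Binary.PropositionalEquality using (_≡_; _≢_)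
open import Relation.Nullary using (¬_)

KVertex : ℕ → ℕ → Set
KVertex n k = Σ (Subset n) (λ s → ∣ s ∣ ≡ k)

Adj : ∀ {n k} → KVertex n k → KVertex n k → Set
Adj {n} u v = proj₁ u ∩ proj₁ v ≡ ⊥

data Walk {n k : ℕ} : KVertex n k → KVertex n k → ℕ → Set where
  here : ∀ {u} → Walk u u zero
  step : ∀ {u w v m} → Adj u w → Walk w v m → Walk u v (suc m)

Dist : ∀ {n k} → KVertex n k → KVertex n k → ℕ → Set
Dist u v m = Walk u v m × (∀ j → j < m → ¬ Walk u v j)

Resolving : ∀ {n k} → List (KVertex n k) → Set
Resolving {n} {k} S =
  ∀ (u v : KVertex n k) → proj₁ u ≢ proj₁ v →
  ∃ λ x → x ∈ S × ∃ λ a → ∃ λ b → Dist u x a × Dist v x b × a ≢ b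

module Submission where

-- Write n = 2k + c and k = t + c; the hypotheses say exactly 2 ≤ t ≤ c + 1. In this range the
-- distance between distinct k-sets meeting in s points is δ t s: 1 if s = 0, 2 if s ≥ t and
-- 3 otherwise. Let D₁ be the last k + c points and D₂ the first k together with the last c
-- points, and let S consist of all k-subsets of D₁ and of D₂; so ∣ S ∣ = 2·C(k + c, k).
-- As D₁ ∪ D₂ is everything, two distinct vertices u, v differ inside some D ∈ {D₁, D₂}. If u
-- or v lies inside D it is itself in S and distinguishes them. Otherwise, counting the points
-- of D by their membership in u and v (four "cells"), an arithmetic argument on the jumps of
-- δ t produces cell counts of a k-set x ⊆ D with δ t ∣ u ∩ x ∣ ≠ δ t ∣ v ∩ x ∣.

open import Defs
open import Data.Bool using (Bool; true; false; _∧_; if_then_else_)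
open import Data.Bool.Properties using (∧-comm; ∧-zeroʳ) renaming (_≟_ to _≟ᵇ_)
open import Data.Nat using (ℕ; zero; suc; _+_; _*_; _∸_; _≤_; _<_; _/_; z≤n; s≤s; _≤?_; _≟_)
open import Data.Nat.Properties
open import Data.Nat.Combinatorics using (_C_; nCk+nC[k+1]≡[n+1]C[k+1])
open import Data.Nat.DivMod using (m*n/n≡m; /-monoˡ-≤)
open import Data.Nat.Tactic.RingSolver using (solve-∀)
open import Data.Vec using ([]; _∷_; _++_)
open import Data.Vec.Properties using (∷-injectiveʳ)
open import Data.Fin.Subset using (Subset; ∣_∣; _∩_; _∪_; ⊥; ⊤)
open import Data.Fin.Subset.Properties
  using (∩-comm; ∩-identityʳ; ∩-distribˡ-∪; ∪-zeroˡ; ∣p∩q∣≤∣p∣; ∣⊤∣≡n; ∣⊥∣≡0)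
open import Data.Product using (Σ; ∃; ∃₂; _×_; _,_; proj₁; proj₂)
open import Data.Sum using (_⊎_; inj₁; inj₂)
open import Data.List using (List; length)
import Data.List as List
open import Data.List.Properties using (length-map; length-++)
open import Data.List.Membership.Propositional using (_∈_)
open import Data.List.Membership.Propositional.Properties using (∈-map⁺; ∈-++⁺ˡ; ∈-++⁺ʳ)
open import Data.List.Relation.Unary.Any using (here)
open import Function using (_∘_)
open import Relation.Binary.PropositionalEquality
open import Relation.Nullary using (does; yes; no; ¬_; contradiction)

cell : ∀ {n} → Bool → Bool → Subset n → Subset n → Subset n → ℕ
cell a b []          []      []      = 0
cell a b (false ∷ D) (_ ∷ u) (_ ∷ v) = cell a b D u v
cell a b (true ∷ D)  (x ∷ u) (y ∷ v) =
  if does (a ≟ᵇ x) ∧ does (b ≟ᵇ y) then suc (cell a b D u v) else cell a b D u v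

cell-swap : ∀ a b {n} (D u v : Subset n) → cell a b D u v ≡ cell b a D v u
cell-swap a b []          []      []      = refl
cell-swap a b (false ∷ D) (_ ∷ u) (_ ∷ v) = cell-swap a b D u v
cell-swap a b (true ∷ D)  (x ∷ u) (y ∷ v)
  rewrite cell-swap a b D u v | ∧-comm (does (a ≟ᵇ x)) (does (b ≟ᵇ y)) = refl

cells-sum : ∀ {n} (D u v : Subset n) →
  cell false false D u v + cell false true D u v + cell true false D u v + cell true true D u v ≡ ∣ D ∣
cells-sum []          []          []          = refl
cells-sum (false ∷ D) (_ ∷ u)     (_ ∷ v)     = cells-sum D u v
cells-sum (true ∷ D)  (false ∷ u) (false ∷ v) = cong suc (cells-sum D u v)
cells-sum (true ∷ D)  (false ∷ u) (true ∷ v)  =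
  trans (shift (cell false false D u v) _ _ _) (cong suc (cells-sum D u v))
  where shift : ∀ a b c d → a + suc b + c + d ≡ suc (a + b + c + d)
        shift = solve-∀
cells-sum (true ∷ D)  (true ∷ u)  (false ∷ v) =
  trans (shift (cell false false D u v) _ _ _) (cong suc (cells-sum D u v))
  where shift : ∀ a b c d → a + b + suc c + d ≡ suc (a + b + c + d)
        shift = solve-∀
cells-sum (true ∷ D)  (true ∷ u)  (true ∷ v)  = trans (+-suc _ _) (cong suc (cells-sum D u v))

meet-cells : ∀ {n} (D u v : Subset n) → cell true false D u v + cell true true D u v ≡ ∣ u ∩ D ∣
meet-cells []          []          []          = refl
meet-cells (false ∷ D) (x ∷ u)     (_ ∷ v)     rewrite ∧-zeroʳ x = meet-cells D u v
meet-cells (true ∷ D)  (false ∷ u) (_ ∷ v)     = meet-cells D u v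
meet-cells (true ∷ D)  (true ∷ u)  (false ∷ v) = cong suc (meet-cells D u v)
meet-cells (true ∷ D)  (true ∷ u)  (true ∷ v)  = trans (+-suc _ _) (cong suc (meet-cells D u v))

meet-cells′ : ∀ {n} (D u v : Subset n) → cell false true D u v + cell true true D u v ≡ ∣ v ∩ D ∣
meet-cells′ D u v =
  trans (cong₂ _+_ (cell-swap false true D u v) (cell-swap true true D u v)) (meet-cells D v u)

difference : ∀ {n} → Subset n → Subset n → Subset n → ℕ
difference D u v = cell true false D u v + cell false true D u v

agree-on : ∀ {n} (D u v : Subset n) → difference D u v ≡ 0 → u ∩ D ≡ v ∩ D
agree-on []          []          []          _ = refl
agree-on (false ∷ D) (x ∷ u)     (y ∷ v)     e
  rewrite ∧-zeroʳ x | ∧-zeroʳ y = cong (false ∷_) (agree-on D u v e)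
agree-on (true ∷ D)  (false ∷ u) (false ∷ v) e = cong (false ∷_) (agree-on D u v e)
agree-on (true ∷ D)  (true ∷ u)  (true ∷ v)  e = cong (true ∷_) (agree-on D u v e)
agree-on (true ∷ D)  (true ∷ u)  (false ∷ v) ()
agree-on (true ∷ D)  (false ∷ u) (true ∷ v)  e = contradiction (trans (sym (+-suc _ _)) e) λ ()

full-meet⇒inside : ∀ {n} (u D : Subset n) → ∣ u ∩ D ∣ ≡ ∣ u ∣ → u ∩ D ≡ u
full-meet⇒inside []          []          _ = refl
full-meet⇒inside (false ∷ u) (_ ∷ D)     e = cong (false ∷_) (full-meet⇒inside u D e)
full-meet⇒inside (true ∷ u)  (true ∷ D)  e = cong (true ∷_) (full-meet⇒inside u D (suc-injective e))
full-meet⇒inside (true ∷ u)  (false ∷ D) e = contradiction (subst (_≤ ∣ u ∣) e (∣p∩q∣≤∣p∣ u D)) 1+n≰n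

agree-on-cover : ∀ {n} (D₁ D₂ u v : Subset n) → D₁ ∪ D₂ ≡ ⊤ →
  u ∩ D₁ ≡ v ∩ D₁ → u ∩ D₂ ≡ v ∩ D₂ → u ≡ v
agree-on-cover D₁ D₂ u v cover e₁ e₂ = begin
  u                         ≡⟨ sym (∩-identityʳ u) ⟩
  u ∩ ⊤                     ≡⟨ cong (u ∩_) (sym cover) ⟩
  u ∩ (D₁ ∪ D₂)             ≡⟨ ∩-distribˡ-∪ u D₁ D₂ ⟩
  (u ∩ D₁) ∪ (u ∩ D₂)       ≡⟨ cong₂ _∪_ e₁ e₂ ⟩
  (v ∩ D₁) ∪ (v ∩ D₂)       ≡⟨ sym (∩-distribˡ-∪ v D₁ D₂) ⟩
  v ∩ (D₁ ∪ D₂)             ≡⟨ cong (v ∩_) cover ⟩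
  v ∩ ⊤                     ≡⟨ ∩-identityʳ v ⟩
  v                         ∎
  where open ≡-Reasoning

differ-inside-cover : ∀ {n} (D₁ D₂ u v : Subset n) → D₁ ∪ D₂ ≡ ⊤ → u ≢ v →
  1 ≤ difference D₁ u v ⊎ 1 ≤ difference D₂ u v
differ-inside-cover D₁ D₂ u v cover u≢v with difference D₁ u v in e₁ | difference D₂ u v in e₂
... | suc _ | _     = inj₁ (s≤s z≤n)
... | zero  | suc _ = inj₂ (s≤s z≤n)
... | zero  | zero  =
  contradiction (agree-on-cover D₁ D₂ u v cover (agree-on D₁ u v e₁) (agree-on D₂ u v e₂)) u≢v

record Realisation {n} (D u v : Subset n) (n₀₀ n₀₁ n₁₀ n₁₁ : ℕ) : Set where
  field
    x      : Subset n
    inside : x ∩ D ≡ x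
    has₀₀  : cell false false x u v ≡ n₀₀
    has₀₁  : cell false true  x u v ≡ n₀₁
    has₁₀  : cell true  false x u v ≡ n₁₀
    has₁₁  : cell true  true  x u v ≡ n₁₁

  size : ∣ x ∣ ≡ n₀₀ + n₀₁ + n₁₀ + n₁₁
  size = trans (sym (cells-sum x u v))
    (cong₂ _+_ (cong₂ _+_ (cong₂ _+_ has₀₀ has₀₁) has₁₀) has₁₁)

  meet-u : ∣ u ∩ x ∣ ≡ n₁₀ + n₁₁
  meet-u = trans (sym (meet-cells x u v)) (cong₂ _+_ has₁₀ has₁₁)

  meet-v : ∣ v ∩ x ∣ ≡ n₀₁ + n₁₁
  meet-v = trans (sym (meet-cells′ x u v)) (cong₂ _+_ has₀₁ has₁₁)

skip : ∀ {n} {D u v : Subset n} {n₀₀ n₀₁ n₁₀ n₁₁ d a b} →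
  Realisation D u v n₀₀ n₀₁ n₁₀ n₁₁ → Realisation (d ∷ D) (a ∷ u) (b ∷ v) n₀₀ n₀₁ n₁₀ n₁₁
skip r = record { x = false ∷ x ; inside = cong (false ∷_) inside
                ; has₀₀ = has₀₀ ; has₀₁ = has₀₁ ; has₁₀ = has₁₀ ; has₁₁ = has₁₁ }
  where open Realisation r

take₀₀ : ∀ {n} {D u v : Subset n} {n₀₀ n₀₁ n₁₀ n₁₁} → Realisation D u v n₀₀ n₀₁ n₁₀ n₁₁ →
  Realisation (true ∷ D) (false ∷ u) (false ∷ v) (suc n₀₀) n₀₁ n₁₀ n₁₁
take₀₀ r = record { x = true ∷ x ; inside = cong (true ∷_) inside
                  ; has₀₀ = cong suc has₀₀ ; has₀₁ = has₀₁ ; has₁₀ = has₁₀ ; has₁₁ = has₁₁ }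
  where open Realisation r

take₀₁ : ∀ {n} {D u v : Subset n} {n₀₀ n₀₁ n₁₀ n₁₁} → Realisation D u v n₀₀ n₀₁ n₁₀ n₁₁ →
  Realisation (true ∷ D) (false ∷ u) (true ∷ v) n₀₀ (suc n₀₁) n₁₀ n₁₁
take₀₁ r = record { x = true ∷ x ; inside = cong (true ∷_) inside
                  ; has₀₀ = has₀₀ ; has₀₁ = cong suc has₀₁ ; has₁₀ = has₁₀ ; has₁₁ = has₁₁ }
  where open Realisation r

take₁₀ : ∀ {n} {D u v : Subset n} {n₀₀ n₀₁ n₁₀ n₁₁} → Realisation D u v n₀₀ n₀₁ n₁₀ n₁₁ →
  Realisation (true ∷ D) (true ∷ u) (false ∷ v) n₀₀ n₀₁ (suc n₁₀) n₁₁
take₁₀ r = record { x = true ∷ x ; inside = cong (true ∷_) inside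
                  ; has₀₀ = has₀₀ ; has₀₁ = has₀₁ ; has₁₀ = cong suc has₁₀ ; has₁₁ = has₁₁ }
  where open Realisation r

take₁₁ : ∀ {n} {D u v : Subset n} {n₀₀ n₀₁ n₁₀ n₁₁} → Realisation D u v n₀₀ n₀₁ n₁₀ n₁₁ →
  Realisation (true ∷ D) (true ∷ u) (true ∷ v) n₀₀ n₀₁ n₁₀ (suc n₁₁)
take₁₁ r = record { x = true ∷ x ; inside = cong (true ∷_) inside
                  ; has₀₀ = has₀₀ ; has₀₁ = has₀₁ ; has₁₀ = has₁₀ ; has₁₁ = cong suc has₁₁ }
  where open Realisation r

realise : ∀ {n} (D u v : Subset n) {n₀₀ n₀₁ n₁₀ n₁₁ : ℕ} →
  n₀₀ ≤ cell false false D u v → n₀₁ ≤ cell false true D u v →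
  n₁₀ ≤ cell true false D u v → n₁₁ ≤ cell true true D u v →
  Realisation D u v n₀₀ n₀₁ n₁₀ n₁₁
realise [] [] [] z≤n z≤n z≤n z≤n =
  record { x = [] ; inside = refl ; has₀₀ = refl ; has₀₁ = refl ; has₁₀ = refl ; has₁₁ = refl }
realise (false ∷ D) (_ ∷ u) (_ ∷ v) b₀₀ b₀₁ b₁₀ b₁₁ = skip (realise D u v b₀₀ b₀₁ b₁₀ b₁₁)
realise (true ∷ D) (false ∷ u) (false ∷ v) {zero}  z≤n b₀₁ b₁₀ b₁₁ =
  skip (realise D u v z≤n b₀₁ b₁₀ b₁₁)
realise (true ∷ D) (false ∷ u) (false ∷ v) {suc _} (s≤s b₀₀) b₀₁ b₁₀ b₁₁ =
  take₀₀ (realise D u v b₀₀ b₀₁ b₁₀ b₁₁)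
realise (true ∷ D) (false ∷ u) (true ∷ v) {n₀₁ = zero}  b₀₀ z≤n b₁₀ b₁₁ =
  skip (realise D u v b₀₀ z≤n b₁₀ b₁₁)
realise (true ∷ D) (false ∷ u) (true ∷ v) {n₀₁ = suc _} b₀₀ (s≤s b₀₁) b₁₀ b₁₁ =
  take₀₁ (realise D u v b₀₀ b₀₁ b₁₀ b₁₁)
realise (true ∷ D) (true ∷ u) (false ∷ v) {n₁₀ = zero}  b₀₀ b₀₁ z≤n b₁₁ =
  skip (realise D u v b₀₀ b₀₁ z≤n b₁₁)
realise (true ∷ D) (true ∷ u) (false ∷ v) {n₁₀ = suc _} b₀₀ b₀₁ (s≤s b₁₀) b₁₁ =
  take₁₀ (realise D u v b₀₀ b₀₁ b₁₀ b₁₁)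
realise (true ∷ D) (true ∷ u) (true ∷ v) {n₁₁ = zero}  b₀₀ b₀₁ b₁₀ z≤n =
  skip (realise D u v b₀₀ b₀₁ b₁₀ z≤n)
realise (true ∷ D) (true ∷ u) (true ∷ v) {n₁₁ = suc _} b₀₀ b₀₁ b₁₀ (s≤s b₁₁) =
  take₁₁ (realise D u v b₀₀ b₀₁ b₁₀ b₁₁)

omit : ∀ {n j} → KVertex n j → KVertex (suc n) j
omit (x , p) = false ∷ x , p

add : ∀ {n j} → KVertex n j → KVertex (suc n) (suc j)
add (x , p) = true ∷ x , cong suc p

subsets-within : ∀ {n} → Subset n → (j : ℕ) → List (KVertex n j)
subsets-within []          zero    = List.[ [] , refl ]
subsets-within []          (suc j) = List.[]
subsets-within (false ∷ D) j       = List.map omit (subsets-within D j)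
subsets-within (true ∷ D)  zero    = List.map omit (subsets-within D zero)
subsets-within (true ∷ D)  (suc j) =
  List.map omit (subsets-within D (suc j)) List.++ List.map add (subsets-within D j)

length-subsets-within : ∀ {n} (D : Subset n) j → length (subsets-within D j) ≡ ∣ D ∣ C j
length-subsets-within []          zero    = refl
length-subsets-within []          (suc j) = refl
length-subsets-within (false ∷ D) j       =
  trans (length-map omit (subsets-within D j)) (length-subsets-within D j)
length-subsets-within (true ∷ D)  zero    =
  trans (length-map omit (subsets-within D zero)) (length-subsets-within D zero)
length-subsets-within (true ∷ D)  (suc j) = begin
  length (List.map omit (subsets-within D (suc j)) List.++ List.map add (subsets-within D j))
    ≡⟨ length-++ (List.map omit (subsets-within D (suc j))) ⟩
  length (List.map omit (subsets-within D (suc j))) + length (List.map add (subsets-within D j))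
    ≡⟨ cong₂ _+_ (length-map omit (subsets-within D (suc j))) (length-map add (subsets-within D j)) ⟩
  length (subsets-within D (suc j)) + length (subsets-within D j)
    ≡⟨ cong₂ _+_ (length-subsets-within D (suc j)) (length-subsets-within D j) ⟩
  ∣ D ∣ C suc j + ∣ D ∣ C j
    ≡⟨ +-comm (∣ D ∣ C suc j) (∣ D ∣ C j) ⟩
  ∣ D ∣ C j + ∣ D ∣ C suc j
    ≡⟨ nCk+nC[k+1]≡[n+1]C[k+1] ∣ D ∣ j ⟩
  suc ∣ D ∣ C suc j ∎
  where open ≡-Reasoning

∈-subsets-within : ∀ {n j} (D x : Subset n) (p : ∣ x ∣ ≡ j) → x ∩ D ≡ x → (x , p) ∈ subsets-within D j
∈-subsets-within []          []          refl _ = here refl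
∈-subsets-within (false ∷ D) (false ∷ x) p    e = ∈-map⁺ omit (∈-subsets-within D x p (∷-injectiveʳ e))
∈-subsets-within (false ∷ D) (true ∷ x)  p    ()
∈-subsets-within {j = zero}  (true ∷ D) (false ∷ x) p e =
  ∈-map⁺ omit (∈-subsets-within D x p (∷-injectiveʳ e))
∈-subsets-within {j = suc j} (true ∷ D) (false ∷ x) p e =
  ∈-++⁺ˡ (∈-map⁺ omit (∈-subsets-within D x p (∷-injectiveʳ e)))
∈-subsets-within (true ∷ D)  (true ∷ x)  refl e =
  ∈-++⁺ʳ (List.map omit (subsets-within D (suc ∣ x ∣)))
         (∈-map⁺ add (∈-subsets-within D x refl (∷-injectiveʳ e)))

∣p∣≡0⇒p≡⊥ : ∀ {n} (p : Subset n) → ∣ p ∣ ≡ 0 → p ≡ ⊥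
∣p∣≡0⇒p≡⊥ []          _ = refl
∣p∣≡0⇒p≡⊥ (false ∷ p) e = cong (false ∷_) (∣p∣≡0⇒p≡⊥ p e)
∣p∣≡0⇒p≡⊥ (true ∷ p)  ()

cell-⊤-both : ∀ {n} (u v : Subset n) → cell true true ⊤ u v ≡ ∣ u ∩ v ∣
cell-⊤-both []          []          = refl
cell-⊤-both (false ∷ u) (_ ∷ v)     = cell-⊤-both u v
cell-⊤-both (true ∷ u)  (false ∷ v) = cell-⊤-both u v
cell-⊤-both (true ∷ u)  (true ∷ v)  = cong suc (cell-⊤-both u v)

cell-⊤-neither : ∀ {n} (u w v : Subset n) → u ∩ w ≡ ⊥ → w ∩ v ≡ ⊥ → ∣ w ∣ ≤ cell false false ⊤ u v
cell-⊤-neither []          []          []          _  _  = z≤n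
cell-⊤-neither (a ∷ u)     (false ∷ w) (b ∷ v)     e₁ e₂ =
  ≤-trans (cell-⊤-neither u w v (∷-injectiveʳ e₁) (∷-injectiveʳ e₂)) (cell₀₀-step a b)
  where cell₀₀-step : ∀ a b → cell false false ⊤ u v ≤ cell false false (true ∷ ⊤) (a ∷ u) (b ∷ v)
        cell₀₀-step false false = n≤1+n _
        cell₀₀-step false true  = ≤-refl
        cell₀₀-step true  _     = ≤-refl
cell-⊤-neither (false ∷ u) (true ∷ w)  (false ∷ v) e₁ e₂ =
  s≤s (cell-⊤-neither u w v (∷-injectiveʳ e₁) (∷-injectiveʳ e₂))
cell-⊤-neither (true ∷ u)  (true ∷ w)  _           () _
cell-⊤-neither (false ∷ u) (true ∷ w)  (true ∷ v)  _  ()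

snoc : ∀ {n k} {u w v : KVertex n k} {m} → Walk u w m → Adj w v → Walk u v (suc m)
snoc here        a = step a here
snoc (step a′ p) a = step a′ (snoc p a)

-- δ t s is the distance between two distinct k-sets of K(2k + c, k), k = t + c, meeting in
-- s points: 1 if disjoint, 2 if they meet in at least t = k − c points, 3 otherwise.
δ : ℕ → ℕ → ℕ
δ t zero = 1
δ t (suc s) with t ≤? suc s
... | yes _ = 2
... | no  _ = 3

δ≢0 : ∀ t s → δ t s ≢ 0
δ≢0 t zero    ()
δ≢0 t (suc s) with t ≤? suc s
... | yes _ = λ ()
... | no  _ = λ ()

δ-far : ∀ t s → t ≤ suc s → δ t (suc s) ≡ 2
δ-far t s t≤s with t ≤? suc s
... | yes _   = refl
... | no  t≰s = contradiction t≤s t≰s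

δ-near : ∀ t s → suc s < t → δ t (suc s) ≡ 3
δ-near t s s<t with t ≤? suc s
... | yes t≤s = contradiction t≤s (<⇒≱ s<t)
... | no  _   = refl

-- The arithmetic behind the size of the (0,0)-cell of two k-sets: if the four cells
-- a, b, d, e fill 2k + c points and d + e = b + e = k, then a = c + e.
zero-zero-cell : ∀ a b d e c → a + b + d + e ≡ (d + e) + ((b + e) + c) → a ≡ c + e
zero-zero-cell a b d e c total = +-cancelʳ-≡ (b + d + e) a (c + e)
  (trans (regroup₁ a b d e) (trans total (regroup₂ b d e c)))
  where regroup₁ : ∀ a b d e → a + (b + d + e) ≡ a + b + d + e
        regroup₁ = solve-∀
        regroup₂ : ∀ b d e c → d + e + (b + e + c) ≡ c + e + (b + d + e)
        regroup₂ = solve-∀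

-- Distances in K(n, k) for n = 2k + c and k = t + c with t ≤ c + 1: two k-sets meeting in s
-- points have a common neighbour iff s ≥ t, and otherwise (then s ≤ c) a path of length 3.
module Distances (t c : ℕ) (t≤1+c : t ≤ suc c) where

  k n : ℕ
  k = t + c
  n = k + (k + c)

  V : Set
  V = KVertex n k

  only-u : (u x : V) → cell true false ⊤ (proj₁ u) (proj₁ x) + ∣ proj₁ u ∩ proj₁ x ∣ ≡ k
  only-u (U , ∣U∣≡k) (X , _) = begin
    cell true false ⊤ U X + ∣ U ∩ X ∣             ≡⟨ cong (cell true false ⊤ U X +_) (sym (cell-⊤-both U X)) ⟩
    cell true false ⊤ U X + cell true true ⊤ U X  ≡⟨ meet-cells ⊤ U X ⟩
    ∣ U ∩ ⊤ ∣                                     ≡⟨ cong ∣_∣ (∩-identityʳ U) ⟩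
    ∣ U ∣                                         ≡⟨ ∣U∣≡k ⟩
    k                                             ∎
    where open ≡-Reasoning

  outside-both : (u x : V) → cell false false ⊤ (proj₁ u) (proj₁ x) ≡ c + ∣ proj₁ u ∩ proj₁ x ∣
  outside-both u@(U , _) x@(X , _) =
    trans (zero-zero-cell _ _ _ _ c (trans (cells-sum ⊤ U X) (trans (∣⊤∣≡n n) n-split)))
          (cong (c +_) (cell-⊤-both U X))
    where
    in-U : cell true false ⊤ U X + cell true true ⊤ U X ≡ k
    in-U = trans (cong (cell true false ⊤ U X +_) (cell-⊤-both U X)) (only-u u x)
    in-X : cell false true ⊤ U X + cell true true ⊤ U X ≡ k
    in-X = begin
      cell false true ⊤ U X + cell true true ⊤ U X ≡⟨ cong₂ _+_ (cell-swap false true ⊤ U X) (cell-⊤-both U X) ⟩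
      cell true false ⊤ X U + ∣ U ∩ X ∣             ≡⟨ cong (λ s → cell true false ⊤ X U + ∣ s ∣) (∩-comm U X) ⟩
      cell true false ⊤ X U + ∣ X ∩ U ∣             ≡⟨ only-u x u ⟩
      k                                             ∎
      where open ≡-Reasoning
    n-split : n ≡ (cell true false ⊤ U X + cell true true ⊤ U X)
                  + ((cell false true ⊤ U X + cell true true ⊤ U X) + c)
    n-split = sym (cong₂ (λ p q → p + (q + c)) in-U in-X)

  vertex : ∀ {D u v : Subset n} {n₀₀ n₀₁ n₁₀ n₁₁} → Realisation D u v n₀₀ n₀₁ n₁₀ n₁₁ →
    n₀₀ + n₀₁ + n₁₀ + n₁₁ ≡ k → V
  vertex r total = Realisation.x r , trans (Realisation.size r) total

  -- Sets meeting in at least t points have a common neighbour: k of the c + s points outside both.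
  two-step : (u z : V) → t ≤ ∣ proj₁ u ∩ proj₁ z ∣ → Walk u z 2
  two-step u@(U , _) z@(Z , _) t≤s = step {w = w} u∩w≡⊥ (step w∩z≡⊥ here)
    where
    k≤room : k ≤ cell false false ⊤ U Z
    k≤room = subst (k ≤_) (sym (outside-both u z))
               (subst (_≤ c + ∣ U ∩ Z ∣) (+-comm c t) (+-monoʳ-≤ c t≤s))
    r = realise ⊤ U Z k≤room z≤n z≤n z≤n
    open Realisation r
    w : V
    w = vertex r (trans (+-identityʳ _) (trans (+-identityʳ _) (+-identityʳ k)))
    u∩w≡⊥ : U ∩ x ≡ ⊥
    u∩w≡⊥ = ∣p∣≡0⇒p≡⊥ _ meet-u
    w∩z≡⊥ : x ∩ Z ≡ ⊥
    w∩z≡⊥ = trans (∩-comm x Z) (∣p∣≡0⇒p≡⊥ _ meet-v)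

  -- Sets meeting in s ≤ c points are joined by a path of length 3 through the set z made
  -- of u ∖ x and s points outside u ∪ x: z meets u in k − s ≥ t points and misses x.
  three-step : (u x : V) → ∣ proj₁ u ∩ proj₁ x ∣ ≤ c → Walk u x 3
  three-step u@(U , _) x@(X , _) s≤c = snoc (two-step u z t≤u∩z) z∩x≡⊥
    where
    s = ∣ U ∩ X ∣
    r = realise ⊤ U X {s} {0} {cell true false ⊤ U X} {0}
          (subst (s ≤_) (sym (outside-both u x)) (m≤n+m s c)) z≤n ≤-refl z≤n
    open Realisation r renaming (x to Z)
    z : V
    z = vertex r (trans (split-sum s _) (only-u u x))
      where split-sum : ∀ a b → a + 0 + b + 0 ≡ b + a
            split-sum = solve-∀
    t≤u∩z : t ≤ ∣ U ∩ Z ∣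
    t≤u∩z = subst (t ≤_) (sym (trans meet-u (+-identityʳ _)))
              (+-cancelʳ-≤ s t _ (≤-trans (+-monoʳ-≤ t s≤c) (≤-reflexive (sym (only-u u x)))))
    z∩x≡⊥ : Z ∩ X ≡ ⊥
    z∩x≡⊥ = trans (∩-comm Z X) (∣p∣≡0⇒p≡⊥ _ meet-v)

  walk₀ : ∀ {u x : V} → Walk u x 0 → proj₁ u ≡ proj₁ x
  walk₀ here = refl

  walk₁ : ∀ {u x : V} → Walk u x 1 → ∣ proj₁ u ∩ proj₁ x ∣ ≡ 0
  walk₁ (step u∩x≡⊥ here) = trans (cong ∣_∣ u∩x≡⊥) (∣⊥∣≡0 n)

  walk₂ : ∀ {u x : V} → Walk u x 2 → t ≤ ∣ proj₁ u ∩ proj₁ x ∣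
  walk₂ {u@(U , _)} {x@(X , _)} (step {w = (W , ∣W∣≡k)} u∩w≡⊥ (step w∩x≡⊥ here)) =
    +-cancelˡ-≤ c t _ (subst (_≤ c + ∣ U ∩ X ∣) (+-comm t c) k≤c+s)
    where
    k≤c+s : k ≤ c + ∣ U ∩ X ∣
    k≤c+s = subst₂ _≤_ ∣W∣≡k (outside-both u x) (cell-⊤-neither U W X u∩w≡⊥ w∩x≡⊥)

  no-walk-below-1 : ∀ {u x : V} → proj₁ u ≢ proj₁ x → ∀ j → j < 1 → ¬ Walk u x j
  no-walk-below-1 u≢x zero    _         w = u≢x (walk₀ w)
  no-walk-below-1 _   (suc _) (s≤s ())

  no-walk-below-2 : ∀ {u x : V} → proj₁ u ≢ proj₁ x → ∣ proj₁ u ∩ proj₁ x ∣ ≢ 0 →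
    ∀ j → j < 2 → ¬ Walk u x j
  no-walk-below-2 u≢x _   zero    _         = no-walk-below-1 u≢x zero (s≤s z≤n)
  no-walk-below-2 _   s≢0 (suc zero) _      = s≢0 ∘ walk₁
  no-walk-below-2 _   _   (suc (suc _)) (s≤s (s≤s ()))

  no-walk-below-3 : ∀ {u x : V} → proj₁ u ≢ proj₁ x → ∣ proj₁ u ∩ proj₁ x ∣ ≢ 0 →
    ¬ t ≤ ∣ proj₁ u ∩ proj₁ x ∣ → ∀ j → j < 3 → ¬ Walk u x j
  no-walk-below-3 u≢x s≢0 _   zero          _ = no-walk-below-2 u≢x s≢0 zero (s≤s z≤n)
  no-walk-below-3 u≢x s≢0 _   (suc zero)    _ = no-walk-below-2 u≢x s≢0 1 (s≤s (s≤s z≤n))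
  no-walk-below-3 _   _   t≰s (suc (suc zero)) _ = t≰s ∘ walk₂
  no-walk-below-3 _   _   _   (suc (suc (suc _))) (s≤s (s≤s (s≤s ())))

  distance : (u x : V) → proj₁ u ≢ proj₁ x → Dist u x (δ t ∣ proj₁ u ∩ proj₁ x ∣)
  distance u x u≢x with ∣ proj₁ u ∩ proj₁ x ∣ in s-eq
  ... | zero  = step (∣p∣≡0⇒p≡⊥ _ s-eq) here , no-walk-below-1 u≢x
  ... | suc s with t ≤? suc s
  ...   | yes t≤s = two-step u x (subst (t ≤_) (sym s-eq) t≤s) ,
                    no-walk-below-2 u≢x (λ e → 1+n≢0 (trans (sym s-eq) e))
  ...   | no  t≰s = three-step u x (subst (_≤ c) (sym s-eq) (≤-pred (≤-trans (≰⇒> t≰s) t≤1+c))) ,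
                    no-walk-below-3 u≢x (λ e → 1+n≢0 (trans (sym s-eq) e))
                                        (λ t≤s′ → t≰s (subst (t ≤_) s-eq t≤s′))

-- For 2 ≤ t ≤ 1 + c and 1 ≤ m < t + c the value of δ t jumps at some j with j < m ≤ j + c:
-- at j = 0 if m ≤ c, and at j = t − 1 otherwise.
δ-jump : ∀ {t c m} → 2 ≤ t → t ≤ suc c → 1 ≤ m → m < t + c →
  ∃ λ j → j < m × m ≤ j + c × δ t j ≢ δ t (suc j)
δ-jump {t} {c} {m} 2≤t t≤1+c 1≤m m<k with m ≤? c
... | yes m≤c = 0 , 1≤m , m≤c , λ e → 1≢3 (trans e (δ-near t 0 2≤t))
  where 1≢3 : 1 ≢ 3
        1≢3 ()
δ-jump {t@(suc (suc t″))} {c} {m} (s≤s (s≤s z≤n)) t≤1+c 1≤m m<k | no m≰c =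
  suc t″ , ≤-trans t≤1+c (≰⇒> m≰c) , ≤-pred m<k ,
  λ e → 3≢2 (trans (sym (δ-near t t″ ≤-refl)) (trans e (δ-far t (suc t″) ≤-refl)))
  where 3≢2 : 3 ≢ 2
        3≢2 ()

toggle : ∀ t j → δ t j ≢ δ t (suc j) → ∀ b → δ t j ≢ δ t b ⊎ δ t (suc j) ≢ δ t b
toggle t j jump b with δ t j ≟ δ t b
... | yes e = inj₂ λ e′ → jump (trans e (sym e′))
... | no ne = inj₁ ne

split : ∀ a b j → j ≤ a + b → ∃₂ λ x y → x ≤ a × y ≤ b × x + y ≡ j
split zero    b j       j≤b       = 0 , j , z≤n , j≤b , refl
split (suc a) b zero    _         = 0 , 0 , z≤n , z≤n , refl
split (suc a) b (suc j) (s≤s j≤a+b) with split a b j j≤a+b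
... | x , y , x≤a , y≤b , e = suc x , y , s≤s x≤a , y≤b , cong suc e

exchange : ∀ x y z w → x + y ≡ z + w → y ≤ z → w ≤ x
exchange x y z w e y≤z = +-cancelˡ-≤ z w x (begin
  z + w ≡⟨ sym e ⟩
  x + y ≤⟨ +-monoʳ-≤ x y≤z ⟩
  x + z ≡⟨ +-comm x z ⟩
  z + x ∎)
  where open ≤-Reasoning

-- Cell counts n_ab ≤ c_ab of a (t + c)-set x whose meets with u (cells 10, 11) and with
-- v (cells 01, 11) lie at different δ t-distances.
record Separating (t c c₀₀ c₀₁ c₁₀ c₁₁ : ℕ) : Set where
  field
    n₀₀ n₀₁ n₁₀ n₁₁ : ℕ
    n₀₀≤ : n₀₀ ≤ c₀₀
    n₀₁≤ : n₀₁ ≤ c₀₁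
    n₁₀≤ : n₁₀ ≤ c₁₀
    n₁₁≤ : n₁₁ ≤ c₁₁
    total : n₀₀ + n₀₁ + n₁₀ + n₁₁ ≡ t + c
    separates : δ t (n₁₀ + n₁₁) ≢ δ t (n₀₁ + n₁₁)

middle-swap : ∀ a b d e → a + d + b + e ≡ a + b + d + e
middle-swap = solve-∀

swap : ∀ {t c c₀₀ c₀₁ c₁₀ c₁₁} → Separating t c c₀₀ c₁₀ c₀₁ c₁₁ → Separating t c c₀₀ c₀₁ c₁₀ c₁₁
swap p = record
  { n₀₀ = n₀₀ ; n₀₁ = n₁₀ ; n₁₀ = n₀₁ ; n₁₁ = n₁₁
  ; n₀₀≤ = n₀₀≤ ; n₀₁≤ = n₁₀≤ ; n₁₀≤ = n₀₁≤ ; n₁₁≤ = n₁₁≤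
  ; total = trans (middle-swap n₀₀ n₀₁ n₁₀ n₁₁) total
  ; separates = separates ∘ sym }
  where open Separating p

-- If the cells are split into a part of size m ≤ j + c and a rest, and k = 1 + j + r,
-- then the rest has room for r more points.
room : ∀ rest m j r c → rest + suc m ≡ (suc j + r) + c → m ≤ j + c → r ≤ rest
room rest m j r c cells m≤j+c =
  exchange rest (suc m) (suc j + c) r (trans cells (regroup (suc j) r c)) (s≤s m≤j+c)
  where regroup : ∀ a b c → a + b + c ≡ a + c + b
        regroup = solve-∀

-- Regrouping the cells as the part outside u plus the part inside u.
regroup-by-u : ∀ a b d e → a + b + suc (suc d + e) ≡ suc a + b + suc d + e
regroup-by-u = solve-∀

-- Case c₀₀ ≥ 1, c₁₀ ≥ 1. With the jump j of δ for m = ∣ u ∩ D ∣, take j points of u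
-- (cells 10, 11), k − 1 − j points outside u (cells 00, 01), and one last point either in
-- cell 00 or in cell 10: the meet with u is j or 1 + j, that with v is unchanged.
separating-via-00 : ∀ {t c} → 2 ≤ t → t ≤ suc c → ∀ a₀₀ c₀₁ a₁₀ c₁₁ →
  suc a₀₀ + c₀₁ + suc a₁₀ + c₁₁ ≡ (t + c) + c → suc a₁₀ + c₁₁ < t + c →
  Separating t c (suc a₀₀) c₀₁ (suc a₁₀) c₁₁
separating-via-00 {t} {c} 2≤t t≤1+c a₀₀ c₀₁ a₁₀ c₁₁ cells m<k
  with δ-jump 2≤t t≤1+c (s≤s z≤n) m<k
... | j , j<m , m≤j+c , jump
  with m≤n⇒∃[o]m+o≡n (<-trans j<m m<k)
... | r , k≡1+j+r
  with split a₁₀ c₁₁ j (≤-pred j<m)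
... | n₁₀ , n₁₁ , n₁₀≤ , n₁₁≤ , in-u
  with split a₀₀ c₀₁ r (room (a₀₀ + c₀₁) (suc a₁₀ + c₁₁) j r c
         (trans (regroup-by-u a₀₀ c₀₁ a₁₀ c₁₁) (trans cells (cong (_+ c) (sym k≡1+j+r)))) m≤j+c)
... | n₀₀ , n₀₁ , n₀₀≤ , n₀₁≤ , out-u
  with toggle t j jump (n₀₁ + n₁₁)
... | inj₁ ne = record
  { n₀₀ = suc n₀₀ ; n₀₁ = n₀₁ ; n₁₀ = n₁₀ ; n₁₁ = n₁₁
  ; n₀₀≤ = s≤s n₀₀≤ ; n₀₁≤ = n₀₁≤ ; n₁₀≤ = m≤n⇒m≤1+n n₁₀≤ ; n₁₁≤ = n₁₁≤
  ; total = trans (shape₀₀ n₀₀ n₀₁ n₁₀ n₁₁) (trans (cong suc (cong₂ _+_ in-u out-u)) k≡1+j+r)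
  ; separates = λ e → ne (trans (cong (δ t) (sym in-u)) e) }
  where shape₀₀ : ∀ a b d e → suc a + b + d + e ≡ suc ((d + e) + (a + b))
        shape₀₀ = solve-∀
... | inj₂ ne = record
  { n₀₀ = n₀₀ ; n₀₁ = n₀₁ ; n₁₀ = suc n₁₀ ; n₁₁ = n₁₁
  ; n₀₀≤ = m≤n⇒m≤1+n n₀₀≤ ; n₀₁≤ = n₀₁≤ ; n₁₀≤ = s≤s n₁₀≤ ; n₁₁≤ = n₁₁≤
  ; total = trans (shape₁₀ n₀₀ n₀₁ n₁₀ n₁₁) (trans (cong suc (cong₂ _+_ in-u out-u)) k≡1+j+r)
  ; separates = λ e → ne (trans (cong (δ t ∘ suc) (sym in-u)) e) }
  where shape₁₀ : ∀ a b d e → a + b + suc d + e ≡ suc ((d + e) + (a + b))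
        shape₁₀ = solve-∀

-- Regrouping the cells as the part outside v ∖ u plus the part inside v.
regroup-by-v : ∀ a b e → a + suc (b + suc e) ≡ 0 + b + suc a + suc e
regroup-by-v = solve-∀

-- Case c₀₀ = 0, c₁₀ ≥ 1, c₁₁ ≥ 1. With the jump j of δ for m = ∣ v ∩ D ∣, take j points of v
-- (cells 01, 11), k − 1 − j points of u ∖ v (cell 10), and one last point either in cell 10
-- or in cell 11: the meet with v is j or 1 + j, that with u is unchanged.
separating-via-11 : ∀ {t c} → 2 ≤ t → t ≤ suc c → ∀ c₀₁ a₁₀ a₁₁ →
  0 + c₀₁ + suc a₁₀ + suc a₁₁ ≡ (t + c) + c → c₀₁ + suc a₁₁ < t + c →
  Separating t c 0 c₀₁ (suc a₁₀) (suc a₁₁)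
separating-via-11 {t} {c} 2≤t t≤1+c c₀₁ a₁₀ a₁₁ cells m<k
  with δ-jump 2≤t t≤1+c (≤-trans (s≤s z≤n) (m≤n+m (suc a₁₁) c₀₁)) m<k
... | j , j<m , m≤j+c , jump
  with m≤n⇒∃[o]m+o≡n (<-trans j<m m<k)
... | r , k≡1+j+r
  with split c₀₁ a₁₁ j (≤-pred (subst (suc j ≤_) (+-suc c₀₁ a₁₁) j<m))
... | n₀₁ , n₁₁ , n₀₁≤ , n₁₁≤ , in-v
  with room a₁₀ (c₀₁ + suc a₁₁) j r c
         (trans (regroup-by-v a₁₀ c₀₁ a₁₁) (trans cells (cong (_+ c) (sym k≡1+j+r)))) m≤j+c
... | r≤a₁₀
  with toggle t j jump (suc (r + n₁₁))
... | inj₁ ne = record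
  { n₀₀ = 0 ; n₀₁ = n₀₁ ; n₁₀ = suc r ; n₁₁ = n₁₁
  ; n₀₀≤ = z≤n ; n₀₁≤ = n₀₁≤ ; n₁₀≤ = s≤s r≤a₁₀ ; n₁₁≤ = m≤n⇒m≤1+n n₁₁≤
  ; total = trans (shape₁₀ n₀₁ r n₁₁) (trans (cong (suc ∘ (_+ r)) in-v) k≡1+j+r)
  ; separates = λ e → ne (sym (trans e (cong (δ t) in-v))) }
  where
  shape₁₀ : ∀ b r e → 0 + b + suc r + e ≡ suc ((b + e) + r)
  shape₁₀ = solve-∀
... | inj₂ ne = record
  { n₀₀ = 0 ; n₀₁ = n₀₁ ; n₁₀ = r ; n₁₁ = suc n₁₁
  ; n₀₀≤ = z≤n ; n₀₁≤ = n₀₁≤ ; n₁₀≤ = m≤n⇒m≤1+n r≤a₁₀ ; n₁₁≤ = s≤s n₁₁≤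
  ; total = trans (shape₁₁ n₀₁ r n₁₁) (trans (cong (suc ∘ (_+ r)) in-v) k≡1+j+r)
  ; separates = λ e → ne (sym (trans (cong (δ t) (sym (+-suc r n₁₁)))
                                 (trans e (cong (δ t) (trans (+-suc n₀₁ n₁₁) (cong suc in-v)))))) }
  where
  shape₁₁ : ∀ b r e → 0 + b + r + suc e ≡ suc ((b + e) + r)
  shape₁₁ = solve-∀

other-exceeds : ∀ a b k c → a + b ≡ k + c → b < k → suc c ≤ a
other-exceeds a b k c a+b≡k+c b<k =
  exchange a (suc b) k (suc c) (trans (+-suc a b) (trans (cong suc a+b≡k+c) (sym (+-suc k c)))) b<k

-- Case c₀₀ = c₁₁ = 0: D consists of u ∖ v and v ∖ u, each with at least c + 1 ≥ t points;
-- take t − 1 points of u ∖ v and c + 1 points of v ∖ u.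
separating-disjoint : ∀ {t c} → 2 ≤ t → t ≤ suc c → ∀ c₀₁ c₁₀ →
  c₀₁ + c₁₀ ≡ (t + c) + c → c₁₀ < t + c → c₀₁ < t + c → Separating t c 0 c₀₁ c₁₀ 0
separating-disjoint {t@(suc (suc t″))} {c} (s≤s (s≤s z≤n)) t≤1+c c₀₁ c₁₀ cells c₁₀<k c₀₁<k = record
  { n₀₀ = 0 ; n₀₁ = suc c ; n₁₀ = suc t″ ; n₁₁ = 0
  ; n₀₀≤ = z≤n
  ; n₀₁≤ = other-exceeds c₀₁ c₁₀ (t + c) c cells c₁₀<k
  ; n₁₀≤ = ≤-trans (n≤1+n (suc t″))
           (≤-trans t≤1+c (other-exceeds c₁₀ c₀₁ (t + c) c (trans (+-comm c₁₀ c₀₁) cells) c₀₁<k))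
  ; n₁₁≤ = z≤n
  ; total = shape c t″
  ; separates = λ e → 3≢2 (begin
      3                  ≡⟨ sym (δ-near t t″ ≤-refl) ⟩
      δ t (suc t″)       ≡⟨ cong (δ t) (sym (+-identityʳ (suc t″))) ⟩
      δ t (suc t″ + 0)   ≡⟨ e ⟩
      δ t (suc c + 0)    ≡⟨ cong (δ t) (+-identityʳ (suc c)) ⟩
      δ t (suc c)        ≡⟨ δ-far t c t≤1+c ⟩
      2                  ∎) }
  where
  open ≡-Reasoning
  3≢2 : 3 ≢ 2
  3≢2 ()
  shape : ∀ c t″ → 0 + suc c + suc t″ + 0 ≡ suc (suc t″) + c
  shape = solve-∀

separating-inside-u : ∀ {t c} → 2 ≤ t → t ≤ suc c → ∀ c₀₀ c₀₁ a₁₀ c₁₁ →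
  c₀₀ + c₀₁ + suc a₁₀ + c₁₁ ≡ (t + c) + c → suc a₁₀ + c₁₁ < t + c → c₀₁ + c₁₁ < t + c →
  Separating t c c₀₀ c₀₁ (suc a₁₀) c₁₁
separating-inside-u 2≤t t≤1+c (suc a₀₀) c₀₁ a₁₀ c₁₁ cells mᵤ<k _ =
  separating-via-00 2≤t t≤1+c a₀₀ c₀₁ a₁₀ c₁₁ cells mᵤ<k
separating-inside-u 2≤t t≤1+c zero c₀₁ a₁₀ (suc a₁₁) cells _ mᵥ<k =
  separating-via-11 2≤t t≤1+c c₀₁ a₁₀ a₁₁ cells mᵥ<k
separating-inside-u {t} {c} 2≤t t≤1+c zero c₀₁ a₁₀ zero cells mᵤ<k mᵥ<k =
  separating-disjoint 2≤t t≤1+c c₀₁ (suc a₁₀) (trans (sym (+-identityʳ _)) cells)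
    (subst (_< t + c) (+-identityʳ _) mᵤ<k) (subst (_< t + c) (+-identityʳ c₀₁) mᵥ<k)

-- The arithmetic core: whenever u, v ⊄ D and u, v differ inside D (a set of k + c points),
-- the cell counts of some k-subset of D separate u from v.
separating-profile : ∀ {t c} → 2 ≤ t → t ≤ suc c → ∀ c₀₀ c₀₁ c₁₀ c₁₁ →
  c₀₀ + c₀₁ + c₁₀ + c₁₁ ≡ (t + c) + c → c₁₀ + c₁₁ < t + c → c₀₁ + c₁₁ < t + c →
  1 ≤ c₁₀ + c₀₁ → Separating t c c₀₀ c₀₁ c₁₀ c₁₁
separating-profile 2≤t t≤1+c c₀₀ c₀₁ (suc a₁₀) c₁₁ cells mᵤ<k mᵥ<k _ =
  separating-inside-u 2≤t t≤1+c c₀₀ c₀₁ a₁₀ c₁₁ cells mᵤ<k mᵥ<k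
separating-profile 2≤t t≤1+c c₀₀ (suc a₀₁) zero c₁₁ cells mᵤ<k mᵥ<k _ =
  swap (separating-inside-u 2≤t t≤1+c c₀₀ zero a₀₁ c₁₁
         (trans (middle-swap c₀₀ (suc a₀₁) zero c₁₁) cells) mᵥ<k mᵤ<k)

∣⊥++p∣ : ∀ m {l} (p : Subset l) → ∣ ⊥ {m} ++ p ∣ ≡ ∣ p ∣
∣⊥++p∣ zero    p = refl
∣⊥++p∣ (suc m) p = ∣⊥++p∣ m p

∣⊤++p∣ : ∀ m {l} (p : Subset l) → ∣ ⊤ {m} ++ p ∣ ≡ m + ∣ p ∣
∣⊤++p∣ zero    p = refl
∣⊤++p∣ (suc m) p = cong suc (∣⊤++p∣ m p)

complementary-blocks : ∀ m {l} (q : Subset l) → (⊥ {m} ++ ⊤) ∪ (⊤ {m} ++ q) ≡ ⊤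
complementary-blocks zero    q = ∪-zeroˡ q
complementary-blocks (suc m) q = cong (true ∷_) (complementary-blocks m q)

module ResolvingSet (t c : ℕ) (2≤t : 2 ≤ t) (t≤1+c : t ≤ suc c) where
  open Distances t c t≤1+c

  D₁ D₂ : Subset n
  D₁ = ⊥ {k} ++ ⊤ {k + c}
  D₂ = ⊤ {k} ++ (⊥ {k} ++ ⊤ {c})

  ∣D₁∣ : ∣ D₁ ∣ ≡ k + c
  ∣D₁∣ = trans (∣⊥++p∣ k ⊤) (∣⊤∣≡n (k + c))

  ∣D₂∣ : ∣ D₂ ∣ ≡ k + c
  ∣D₂∣ = trans (∣⊤++p∣ k (⊥ {k} ++ ⊤)) (cong (k +_) (trans (∣⊥++p∣ k ⊤) (∣⊤∣≡n c)))

  S : List V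
  S = subsets-within D₁ k List.++ subsets-within D₂ k

  Distinguishes : V → V → V → Set
  Distinguishes u v x = ∃ λ a → ∃ λ b → Dist u x a × Dist v x b × a ≢ b

  dist-self : (u : V) → Dist u u 0
  dist-self u = here , λ _ ()

  -- Each of two distinct vertices distinguishes them, being the only one at distance 0.
  left-distinguishes : (u v : V) → proj₁ u ≢ proj₁ v → Distinguishes u v u
  left-distinguishes u v u≢v =
    0 , _ , dist-self u , distance v u (u≢v ∘ sym) , λ e → δ≢0 t ∣ proj₁ v ∩ proj₁ u ∣ (sym e)

  right-distinguishes : (u v : V) → proj₁ u ≢ proj₁ v → Distinguishes u v v
  right-distinguishes u v u≢v = _ , 0 , distance u v u≢v , dist-self v , δ≢0 t ∣ proj₁ u ∩ proj₁ v ∣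

  separating-subset : (D : Subset n) → ∣ D ∣ ≡ k + c → (u v : V) → proj₁ u ≢ proj₁ v →
    1 ≤ difference D (proj₁ u) (proj₁ v) →
    ∣ proj₁ u ∩ D ∣ ≢ k → ∣ proj₁ v ∩ D ∣ ≢ k →
    ∃ λ x → x ∈ subsets-within D k × Distinguishes u v x
  separating-subset D ∣D∣ u@(U , ∣U∣) v@(W , ∣W∣) u≢v diff u⊄D v⊄D =
    x , ∈-subsets-within D X (proj₂ x) inside ,
    _ , _ , distance u x (outside u⊄D) , distance v x (outside v⊄D) ,
    λ e → separates (trans (cong (δ t) (sym meet-u)) (trans e (cong (δ t) meet-v)))
    where
    meet<k : ∀ (Y : Subset n) {m} → ∣ Y ∣ ≡ k → m ≡ ∣ Y ∩ D ∣ → ∣ Y ∩ D ∣ ≢ k → m < k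
    meet<k Y ∣Y∣ refl Y⊄D = ≤∧≢⇒< (subst (∣ Y ∩ D ∣ ≤_) ∣Y∣ (∣p∩q∣≤∣p∣ Y D)) Y⊄D
    profile = separating-profile 2≤t t≤1+c
                (cell false false D U W) (cell false true D U W) (cell true false D U W) (cell true true D U W)
                (trans (cells-sum D U W) ∣D∣)
                (meet<k U ∣U∣ (meet-cells D U W) u⊄D) (meet<k W ∣W∣ (meet-cells′ D U W) v⊄D) diff
    open Separating profile
    r = realise D U W n₀₀≤ n₀₁≤ n₁₀≤ n₁₁≤
    open Realisation r renaming (x to X)
    x : V
    x = vertex r total
    outside : ∀ {Y : Subset n} → ∣ Y ∩ D ∣ ≢ k → Y ≢ X
    outside Y⊄D refl = Y⊄D (trans (cong ∣_∣ inside) (proj₂ x))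

  distinguish-within : (D : Subset n) → ∣ D ∣ ≡ k + c → (u v : V) → proj₁ u ≢ proj₁ v →
    1 ≤ difference D (proj₁ u) (proj₁ v) → ∃ λ x → x ∈ subsets-within D k × Distinguishes u v x
  distinguish-within D ∣D∣ u@(U , ∣U∣) v@(W , ∣W∣) u≢v diff with ∣ U ∩ D ∣ ≟ k | ∣ W ∩ D ∣ ≟ k
  ... | yes u⊆D | _ =
    u , ∈-subsets-within D U ∣U∣ (full-meet⇒inside U D (trans u⊆D (sym ∣U∣))) , left-distinguishes u v u≢v
  ... | no _ | yes v⊆D =
    v , ∈-subsets-within D W ∣W∣ (full-meet⇒inside W D (trans v⊆D (sym ∣W∣))) , right-distinguishes u v u≢v
  ... | no u⊄D | no v⊄D = separating-subset D ∣D∣ u v u≢v diff u⊄D v⊄D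

  resolving : Resolving S
  resolving u v u≢v with differ-inside-cover D₁ D₂ (proj₁ u) (proj₁ v) (complementary-blocks k _) u≢v
  ... | inj₁ diff = let x , x∈ , d = distinguish-within D₁ ∣D₁∣ u v u≢v diff in x , ∈-++⁺ˡ x∈ , d
  ... | inj₂ diff = let x , x∈ , d = distinguish-within D₂ ∣D₂∣ u v u≢v diff in x , ∈-++⁺ʳ _ x∈ , d

  size : length S ≡ 2 * ((n ∸ k) C k)
  size = begin
    length S                                     ≡⟨ length-++ (subsets-within D₁ k) ⟩
    length (subsets-within D₁ k) + length (subsets-within D₂ k)
      ≡⟨ cong₂ _+_ (length-subsets-within D₁ k) (length-subsets-within D₂ k) ⟩
    ∣ D₁ ∣ C k + ∣ D₂ ∣ C k                      ≡⟨ cong₂ (λ a b → a C k + b C k) ∣D₁∣ ∣D₂∣ ⟩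
    (k + c) C k + (k + c) C k                    ≡⟨ cong ((k + c) C k +_) (sym (+-identityʳ _)) ⟩
    2 * ((k + c) C k)                            ≡⟨ cong (λ m → 2 * (m C k)) (sym (m+n∸m≡n k (k + c))) ⟩
    2 * ((n ∸ k) C k)                            ∎
    where open ≡-Reasoning

≤-half : ∀ x k → x * 2 ≤ 5 * k → x ≤ (5 * k) / 2
≤-half x k h = subst (_≤ (5 * k) / 2) (m*n/n≡m x 2) (/-monoˡ-≤ 2 h)

lower⇒2k≤n : ∀ n k → (5 * k) / 2 ≤ n → k + k ≤ n
lower⇒2k≤n n k lower =
  ≤-trans (≤-half (k + k) k (subst (_≤ 5 * k) (sym (double k)) (*-monoˡ-≤ k (n≤1+n 4)))) lower
  where double : ∀ k → (k + k) * 2 ≡ 4 * k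
        double = solve-∀

upper⇒2+c≤k : ∀ n k c → k + (k + c) ≡ n → n + 2 ≤ 3 * k → 2 + c ≤ k
upper⇒2+c≤k _ k c refl upper =
  +-cancelˡ-≤ (k + k) (2 + c) k (subst₂ _≤_ (regroup k c) (triple k) upper)
  where regroup : ∀ k c → k + (k + c) + 2 ≡ k + k + (2 + c)
        regroup = solve-∀
        triple : ∀ k → 3 * k ≡ k + k + k
        triple = solve-∀

beyond-range : ∀ t c → 2 + c ≤ t → suc ((t + c) + ((t + c) + c)) * 2 ≤ 5 * (t + c)
beyond-range t c 2+c≤t with m≤n⇒∃[o]m+o≡n 2+c≤t
... | d , refl = ≤-trans (m≤m+n _ d) (≤-reflexive (excess c d))
  where excess : ∀ c d → let k = 2 + c + d + c in suc (k + (k + c)) * 2 + d ≡ 5 * k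
        excess = solve-∀

lower⇒t≤1+c : ∀ n k t c → t + c ≡ k → k + (k + c) ≡ n → (5 * k) / 2 ≤ n → t ≤ suc c
lower⇒t≤1+c _ _ t c refl refl lower with t ≤? suc c
... | yes t≤1+c = t≤1+c
... | no  t≰1+c =
  contradiction (≤-trans (≤-half _ (t + c) (beyond-range t c (≰⇒> t≰1+c))) lower) 1+n≰n

record Parameters (n k : ℕ) : Set where
  field
    t c    : ℕ
    2≤t    : 2 ≤ t
    t≤1+c  : t ≤ suc c
    k≡t+c  : t + c ≡ k
    n≡2k+c : k + (k + c) ≡ n

parameters : ∀ n k → (5 * k) / 2 ≤ n → n + 2 ≤ 3 * k → Parameters n k
parameters n k lower upper = record
  { t = k ∸ c ; c = c
  ; 2≤t = m+n≤o⇒m≤o∸n 2 2+c≤k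
  ; t≤1+c = lower⇒t≤1+c n k (k ∸ c) c t+c≡k n≡ lower
  ; k≡t+c = t+c≡k
  ; n≡2k+c = n≡ }
  where
  c = n ∸ (k + k)
  n≡ : k + (k + c) ≡ n
  n≡ = trans (sym (+-assoc k k c)) (m+[n∸m]≡n (lower⇒2k≤n n k lower))
  2+c≤k : 2 + c ≤ k
  2+c≤k = upper⇒2+c≤k n k c n≡ upper
  t+c≡k : k ∸ c + c ≡ k
  t+c≡k = m∸n+n≡m (m+n≤o⇒n≤o 2 2+c≤k)

resolving-set : ∀ n k t c → 2 ≤ t → t ≤ suc c → t + c ≡ k → k + (k + c) ≡ n →
  Σ (List (KVertex n k)) (λ S → Resolving S × length S ≤ 2 * ((n ∸ k) C k))
resolving-set _ _ t c 2≤t t≤1+c refl refl = S , resolving , ≤-reflexive size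
  where open ResolvingSet t c 2≤t t≤1+c

theorem2p4 : ∀ (n k : ℕ) → (5 * k) / 2 ≤ n → n + 2 ≤ 3 * k →
    Σ (List (KVertex n k)) (λ S → Resolving S × length S ≤ 2 * ((n ∸ k) C k))
theorem2p4 n k lower upper = resolving-set n k t c 2≤t t≤1+c k≡t+c n≡2k+c
  where open Parameters (parameters n k lower upper)
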